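{- Let $T$ be a finite tree and let $M$ be a minimal dominating set of $T$ with $|M|=\Gamma(T)$. Then (i) $|a_1(M)|=|N_1(M)|$; (ii) for every $X\subseteq N_2(M)$, $|X|\le|N(X)\cap a_2(M)|$.
   Context: A dominating set of a graph $G=(V,E)$ is a set $S\subseteq V$ with $N[S]=V$ ($N[v]$ closed neighbourhood, $N(X)=\bigcup_{x\in X}N(x)$ open neighbourhood); it is minimal if no proper subset is dominating. $\Gamma(G)$ is the maximum size of a minimal dominating set. For a dominating set $S$: $a(S)=\{u\in S: S\setminus\{u\}\text{ is not dominating}\}$; $N_1(S)=\{u\in V\setminus S: |N[u]\cap S|=1\}$; $N_2(S)=\{u\in V\setminus S:|N[u]\cap S|\ge2\}$; $a_1(S)=\{u\in a(S): N[u]\cap N_1(S)\ne\emptyset\}$; $a_2(S)=\{u\in a(S): N[u]\cap N_1(S)=\emptyset\}$. -}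

module Defs where

open import Data.Nat using (ℕ; _<_; _≤_; _≥_; _≡ᵇ_; _≤ᵇ_)
import Data.Bool as Bool
open import Data.Bool using (Bool; true; false; _∧_; _∨_; not)
open import Data.Fin using (Fin; _≟_)
open import Data.Fin.Subset using (Subset; _∈_; _∩_; ∣_∣; Nonempty; _─_; ⁅_⁆; _⊆_)
open import Data.Fin.Subset.Properties using (nonempty?)
open import Data.Fin.Properties using (any?; all?)
open import Data.Vec using (tabulate; lookup)
open import Data.List using (List; []; _∷_; length)
open import Data.List.Relation.Unary.Unique.Propositional using (Unique)
open import Data.Product using (Σ; ∃; _×_)
open import Relation.Nullary using (¬_; Dec; does)
open import Relation.Binary.PropositionalEquality using (_≡_; _≢_)

record Graph (n : ℕ) : Set where
  field
    E     : Fin n → Fin n → Bool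
    sym   : ∀ u v → E u v ≡ E v u
    irrefl : ∀ u → E u u ≡ false

module _ {n : ℕ} (G : Graph n) where
  open Graph G

  Adj : Fin n → Fin n → Set
  Adj u v = E u v ≡ true

  data Walk : Fin n → Fin n → Set where
    here : ∀ {u} → Walk u u
    step : ∀ {u w v} → Adj u w → Walk w v → Walk u v

  verts : ∀ {u v} → Walk u v → List (Fin n)
  verts (here {u}) = u ∷ []
  verts (step {u} _ p) = u ∷ verts p

  Connected : Set
  Connected = ∀ u v → Walk u v

  HasCycle : Set
  HasCycle = Σ (Fin n) λ u → Σ (Fin n) λ v → Σ (Walk u v) λ p →
               Adj v u × Unique (verts p) × length (verts p) ≥ 3

  IsTree : Set
  IsTree = 0 < n × Connected × ¬ HasCycle

  closedAdj : Fin n → Fin n → Bool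
  closedAdj u v = does (u ≟ v) ∨ E u v

  N[_] : Fin n → Subset n
  N[ u ] = tabulate (closedAdj u)

  N⟨_⟩ : Subset n → Subset n
  N⟨ X ⟩ = tabulate λ v → does (any? λ x → (lookup X x ∧ E x v) Bool.≟ true)

  Dominating : Subset n → Set
  Dominating S = ∀ v → Nonempty (N[ v ] ∩ S)

  dominating? : (S : Subset n) → Dec (Dominating S)
  dominating? S = all? λ v → nonempty? (N[ v ] ∩ S)

  MinimalDominating : Subset n → Set
  MinimalDominating S = Dominating S × (∀ T → T ⊆ S → T ≢ S → ¬ Dominating T)

  -- |S| = Γ(G): S is a minimal dominating set of maximum size among minimal dominating sets
  MaxMinimalDominating : Subset n → Set
  MaxMinimalDominating S = MinimalDominating S × (∀ T → MinimalDominating T → ∣ T ∣ ≤ ∣ S ∣)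

  module _ (S : Subset n) where
    a : Subset n
    a = tabulate λ u → lookup S u ∧ not (does (dominating? (S ─ ⁅ u ⁆)))

    N₁ : Subset n
    N₁ = tabulate λ u → not (lookup S u) ∧ (∣ N[ u ] ∩ S ∣ ≡ᵇ 1)

    N₂ : Subset n
    N₂ = tabulate λ u → not (lookup S u) ∧ (2 ≤ᵇ ∣ N[ u ] ∩ S ∣)

    a₁ : Subset n
    a₁ = tabulate λ u → lookup a u ∧ does (nonempty? (N[ u ] ∩ N₁))

    a₂ : Subset n
    a₂ = tabulate λ u → lookup a u ∧ not (does (nonempty? (N[ u ] ∩ N₁)))

-- Since M is minimal, a(M) = M, and a vertex v ∈ a₂(M) has no neighbour in M ∪ N₁(M): some
-- vertex w is dominated by v alone, and w ≠ v would put w in N₁(M) ∩ N[v]. Hence, for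
-- X ⊆ N₂(M), no edge joins Q = M ∪ N₁(M) ∪ X to R = a₂(M) ∖ N(X). A tree is bipartite, say with
-- classes C and ∁C; then (Q ∩ C) ∪ (R ∖ C) and (Q ∖ C) ∪ (R ∩ C) are independent, so they extend
-- to maximal independent sets, which are minimal dominating sets and thus have at most Γ = |M|
-- elements. Adding up, |Q| + |R| ≤ 2|M|, which unfolds to |N₁| + |X| ≤ |a₁| + |N(X) ∩ a₂|.
-- Each vertex of N₁ has a unique neighbour in M, so a₁ injects into N₁; with X = ∅ this gives (i),
-- and then the inequality gives (ii).
module Submission where

open import Defs
open import Data.Nat using (ℕ; zero; suc; _+_; _∸_; _≤_; _<_; s≤s; z≤n)
open import Data.Nat.Properties
  using ( +-suc; +-assoc; +-identityʳ; +-mono-≤; +-monoˡ-≤; +-monoʳ-<; +-cancelˡ-≤; +-cancelʳ-≤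
        ; ≤-trans; ≤-<-trans; ≤-antisym; <-irrefl; m≤m+n; m≤n+m; ∸-monoʳ-<; ≡ᵇ⇒≡; ≡⇒≡ᵇ; ≤ᵇ⇒≤
        ; module ≤-Reasoning)
open import Data.Nat.Induction using (<-wellFounded)
open import Data.Nat.Solver using (module +-*-Solver)
open import Induction.WellFounded using (Acc; acc)
open import Data.Bool using (Bool; true; false; T; not; _∧_; _xor_)
import Data.Bool as Bool
open import Data.Bool.Properties
  using (T-≡; T-not-≡; T-∧; T-∨; not-involutive; not-distribˡ-xor; not-distribʳ-xor; xor-same)
open import Data.Fin using (Fin; zero; suc; _≟_; fromℕ<)
open import Data.Fin.Properties using (suc-injective; 0≢1+n; any?; ¬∀⟶∃¬)
open import Data.Fin.Subset
  using (Subset; inside; outside; ⊥; _∈_; _∉_; _∩_; _∪_; ∁; ∣_∣; Empty; Nonempty; _⊆_; _⊂_; _-_; ⁅_⁆)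
open import Data.Fin.Subset.Properties
  using ( drop-∷-Empty; drop-∷-⊆; in⊂in; out⊂in; out⊂; ⊆-refl; ⊆-trans; ⊆-antisym; ⊥⊆; ∉⊥; Empty-unique
        ; x∈p∩q⁺; x∈p∩q⁻; x∈p∪q⁺; x∈p∪q⁻; x∈p⇒x∉∁p; x∈∁p⇒x∉p; x∈⁅x⁆; x∈⁅y⁆⇒x≡y; x∈p∧x≢y⇒x∈p-y
        ; p∩q⊆p; p∩q⊆q; q⊆p∪q; p─q⊆p; ∩-comm; ∩-zeroˡ; nonempty?
        ; ∣p∣≤n; ∣⊥∣≡0; ∣⁅x⁆∣≡1; p⊆q⇒∣p∣≤∣q∣; p⊂q⇒∣p∣<∣q∣; x∈p⇒∣p-x∣<∣p∣)
open import Data.Vec using ([]; _∷_; here; there; tabulate; lookup)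
open import Data.Vec.Properties
  using (lookup∘tabulate; tabulate∘lookup; tabulate-∘; tabulate-cong; []=⇒lookup; lookup⇒[]=)
open import Data.List.Relation.Unary.All using ([])
open import Data.List.Relation.Unary.All.Properties using (¬Any⇒All¬)
open import Data.List.Relation.Unary.AllPairs using ([]; _∷_)
open import Data.List.Relation.Unary.Any using (here; there)
open import Data.List.Relation.Unary.Unique.Propositional using (Unique)
import Data.List.Membership.Propositional as List
open import Data.Product using (_,_; ∃; ∃₂; _×_; proj₁; proj₂)
open import Data.Sum using (_⊎_; inj₁; inj₂)
open import Function using (_∘_; Equivalence)
open import Relation.Nullary using (¬_; contradiction; yes; no; Dec; does)
open import Relation.Binary.PropositionalEquality hiding ([_])

open Equivalence using (to; from)

private
  variable
    n : ℕ

∣p∪q∣≡∣p∣+∣q∣ : ∀ (p q : Subset n) → Empty (p ∩ q) → ∣ p ∪ q ∣ ≡ ∣ p ∣ + ∣ q ∣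
∣p∪q∣≡∣p∣+∣q∣ []            []            _     = refl
∣p∪q∣≡∣p∣+∣q∣ (inside ∷ p)  (inside ∷ q)  p∩q=∅ = contradiction (zero , here) p∩q=∅
∣p∪q∣≡∣p∣+∣q∣ (inside ∷ p)  (outside ∷ q) p∩q=∅ = cong suc (∣p∪q∣≡∣p∣+∣q∣ p q (drop-∷-Empty p∩q=∅))
∣p∪q∣≡∣p∣+∣q∣ (outside ∷ p) (inside ∷ q)  p∩q=∅ =
  trans (cong suc (∣p∪q∣≡∣p∣+∣q∣ p q (drop-∷-Empty p∩q=∅))) (sym (+-suc ∣ p ∣ ∣ q ∣))
∣p∪q∣≡∣p∣+∣q∣ (outside ∷ p) (outside ∷ q) p∩q=∅ = ∣p∪q∣≡∣p∣+∣q∣ p q (drop-∷-Empty p∩q=∅)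

∣p∣≡∣p∩q∣+∣p∩∁q∣ : ∀ (p q : Subset n) → ∣ p ∣ ≡ ∣ p ∩ q ∣ + ∣ p ∩ ∁ q ∣
∣p∣≡∣p∩q∣+∣p∩∁q∣ []            []            = refl
∣p∣≡∣p∩q∣+∣p∩∁q∣ (inside ∷ p)  (inside ∷ q)  = cong suc (∣p∣≡∣p∩q∣+∣p∩∁q∣ p q)
∣p∣≡∣p∩q∣+∣p∩∁q∣ (inside ∷ p)  (outside ∷ q) =
  trans (cong suc (∣p∣≡∣p∩q∣+∣p∩∁q∣ p q)) (sym (+-suc ∣ p ∩ q ∣ ∣ p ∩ ∁ q ∣))
∣p∣≡∣p∩q∣+∣p∩∁q∣ (outside ∷ p) (_ ∷ q)       = ∣p∣≡∣p∩q∣+∣p∩∁q∣ p q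

∩-∩∁-disjoint : ∀ (p q r : Subset n) → Empty ((p ∩ q) ∩ (r ∩ ∁ q))
∩-∩∁-disjoint p q r (x , x∈) with x∈p∩q⁻ (p ∩ q) (r ∩ ∁ q) x∈
... | x∈p∩q , x∈r∩∁q = x∈p⇒x∉∁p (proj₂ (x∈p∩q⁻ p q x∈p∩q)) (proj₂ (x∈p∩q⁻ r (∁ q) x∈r∩∁q))

Empty-∩-⊆ʳ : ∀ {p q r : Subset n} → r ⊆ q → Empty (p ∩ q) → Empty (p ∩ r)
Empty-∩-⊆ʳ {p = p} {r = r} r⊆q p∩q=∅ (x , x∈p∩r) with x∈p∩q⁻ p r x∈p∩r
... | x∈p , x∈r = p∩q=∅ (x , x∈p∩q⁺ (x∈p , r⊆q x∈r))

≡⁅x⁆⁺ : ∀ {p : Subset n} {x} → x ∈ p → (∀ {y} → y ∈ p → y ≡ x) → p ≡ ⁅ x ⁆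
≡⁅x⁆⁺ {p = p} {x} x∈p only-x =
  ⊆-antisym (λ y∈p → subst (_∈ ⁅ x ⁆) (sym (only-x y∈p)) (x∈⁅x⁆ x))
            (λ y∈⁅x⁆ → subst (_∈ p) (sym (x∈⁅y⁆⇒x≡y x y∈⁅x⁆)) x∈p)

∣p∣≡1⇒unique : ∀ {p : Subset n} {x y} → ∣ p ∣ ≡ 1 → x ∈ p → y ∈ p → x ≡ y
∣p∣≡1⇒unique {p = p} {x} {y} ∣p∣≡1 x∈p y∈p with y ≟ x
... | yes y≡x = sym y≡x
... | no y≢x  = contradiction (subst (1 <_) ∣p∣≡1 (≤-<-trans 1≤∣p-x∣ (x∈p⇒∣p-x∣<∣p∣ x∈p))) (<-irrefl refl)
  where
  ⁅y⁆⊆p-x : ⁅ y ⁆ ⊆ p - x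
  ⁅y⁆⊆p-x z∈⁅y⁆ rewrite x∈⁅y⁆⇒x≡y y z∈⁅y⁆ = x∈p∧x≢y⇒x∈p-y y∈p y≢x
  1≤∣p-x∣ : 1 ≤ ∣ p - x ∣
  1≤∣p-x∣ = subst (_≤ ∣ p - x ∣) (∣⁅x⁆∣≡1 y) (p⊆q⇒∣p∣≤∣q∣ ⁅y⁆⊆p-x)

⊆∧≢⇒⊂ : ∀ {p q : Subset n} → p ⊆ q → p ≢ q → p ⊂ q
⊆∧≢⇒⊂ {p = []}          {[]}          _   p≢q = contradiction refl p≢q
⊆∧≢⇒⊂ {p = inside ∷ p}  {inside ∷ q}  p⊆q p≢q = in⊂in (⊆∧≢⇒⊂ (drop-∷-⊆ p⊆q) (p≢q ∘ cong (inside ∷_)))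
⊆∧≢⇒⊂ {p = inside ∷ p}  {outside ∷ q} p⊆q _   = contradiction (p⊆q here) λ ()
⊆∧≢⇒⊂ {p = outside ∷ p} {inside ∷ q}  p⊆q _   = out⊂in (drop-∷-⊆ p⊆q)
⊆∧≢⇒⊂ {p = outside ∷ p} {outside ∷ q} p⊆q p≢q = out⊂ (⊆∧≢⇒⊂ (drop-∷-⊆ p⊆q) (p≢q ∘ cong (outside ∷_)))

injective-relation⇒∣p∣≤∣q∣ : ∀ {m} (p : Subset n) (q : Subset m) {R : Fin n → Fin m → Set} →
  (∀ {i} → i ∈ p → ∃ λ j → j ∈ q × R i j) →
  (∀ {i i′ j} → i ∈ p → i′ ∈ p → j ∈ q → R i j → R i′ j → i ≡ i′) →
  ∣ p ∣ ≤ ∣ q ∣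
injective-relation⇒∣p∣≤∣q∣ []            q total inj = z≤n
injective-relation⇒∣p∣≤∣q∣ (outside ∷ p) q total inj =
  injective-relation⇒∣p∣≤∣q∣ p q (total ∘ there)
    λ i∈p i′∈p j∈q Rij Ri′j → suc-injective (inj (there i∈p) (there i′∈p) j∈q Rij Ri′j)
injective-relation⇒∣p∣≤∣q∣ (inside ∷ p)  q {R} total inj with total here
... | j , j∈q , R0j = ≤-trans (s≤s ∣p∣≤∣q-j∣) (x∈p⇒∣p-x∣<∣p∣ j∈q)
  where
  total′ : ∀ {i} → i ∈ p → ∃ λ j′ → j′ ∈ q - j × R (suc i) j′
  total′ i∈p with total (there i∈p)
  ... | j′ , j′∈q , Rij′ =
    j′ , x∈p∧x≢y⇒x∈p-y j′∈q (λ { refl → 0≢1+n (inj here (there i∈p) j∈q R0j Rij′) }) , Rij′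
  ∣p∣≤∣q-j∣ : ∣ p ∣ ≤ ∣ q - j ∣
  ∣p∣≤∣q-j∣ = injective-relation⇒∣p∣≤∣q∣ p (q - j) total′
    λ i∈p i′∈p j′∈q-j Rij′ Ri′j′ →
      suc-injective (inj (there i∈p) (there i′∈p) (p─q⊆p q ⁅ j ⁆ j′∈q-j) Rij′ Ri′j′)

T-not⇒¬T : ∀ {b} → T (not b) → ¬ T b
T-not⇒¬T {false} _ ()

¬T⇒T-not : ∀ {b} → ¬ T b → T (not b)
¬T⇒T-not {false} _  = _
¬T⇒T-not {true}  ¬T = ¬T _

T-does⁻ : ∀ {P : Set} (P? : Dec P) → T (does P?) → P
T-does⁻ (yes p) _ = p

T-does⁺ : ∀ {P : Set} (P? : Dec P) → P → T (does P?)
T-does⁺ (yes _) _ = _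
T-does⁺ (no ¬p) p = ¬p p

∧-not-does : ∀ {P : Set} b (P? : Dec P) → (T b → ¬ P) → b ∧ not (does P?) ≡ b
∧-not-does false P?      _  = refl
∧-not-does true  (no _)  _  = refl
∧-not-does true  (yes p) ¬P = contradiction p (¬P _)

∈⇒T-lookup : ∀ {p : Subset n} {x} → x ∈ p → T (lookup p x)
∈⇒T-lookup x∈p = from T-≡ ([]=⇒lookup x∈p)

T-lookup⇒∈ : ∀ {p : Subset n} {x} → T (lookup p x) → x ∈ p
T-lookup⇒∈ {p = p} {x} t = lookup⇒[]= x p (to T-≡ t)

∈tabulate⁻ : ∀ {f : Fin n → Bool} {x} → x ∈ tabulate f → T (f x)
∈tabulate⁻ {f = f} {x} x∈ = subst T (lookup∘tabulate f x) (∈⇒T-lookup x∈)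

∈tabulate⁺ : ∀ {f : Fin n → Bool} {x} → T (f x) → x ∈ tabulate f
∈tabulate⁺ {f = f} {x} t = T-lookup⇒∈ (subst T (sym (lookup∘tabulate f x)) t)

tabulate-∧ : ∀ (f g : Fin n → Bool) → tabulate (λ i → f i ∧ g i) ≡ tabulate f ∩ tabulate g
tabulate-∧ {n = zero}  f g = refl
tabulate-∧ {n = suc n} f g = cong (f zero ∧ g zero ∷_) (tabulate-∧ (f ∘ suc) (g ∘ suc))

module _ {n : ℕ} (G : Graph n) where
  open Graph G using (E; irrefl) renaming (sym to E-sym)
  open import Data.List.Membership.DecPropositional (_≟_ {n}) using (_∈?_)

  private
    variable
      u v w x y : Fin n

  Adj-sym : Adj G u v → Adj G v u
  Adj-sym {u} {v} = trans (E-sym v u)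

  Adj-irrefl : ¬ Adj G u u
  Adj-irrefl {u} uu with trans (sym uu) (irrefl u)
  ... | ()

  Adj⇒≢ : Adj G u v → u ≢ v
  Adj⇒≢ uv refl = Adj-irrefl uv

  v∈N[v] : ∀ v → v ∈ N[_] G v
  v∈N[v] v = ∈tabulate⁺ (from T-∨ (inj₁ (T-does⁺ (v ≟ v) refl)))

  Adj⇒∈N[] : Adj G v u → u ∈ N[_] G v
  Adj⇒∈N[] vu = ∈tabulate⁺ (from T-∨ (inj₂ (from T-≡ vu)))

  ∈N[]⁻ : u ∈ N[_] G v → v ≡ u ⊎ Adj G v u
  ∈N[]⁻ {u} {v} u∈ with to T-∨ (∈tabulate⁻ u∈)
  ... | inj₁ t = inj₁ (T-does⁻ (v ≟ u) t)
  ... | inj₂ t = inj₂ (to T-≡ t)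

  ∈N[]-sym : u ∈ N[_] G v → v ∈ N[_] G u
  ∈N[]-sym u∈ with ∈N[]⁻ u∈
  ... | inj₁ refl = v∈N[v] _
  ... | inj₂ vu   = Adj⇒∈N[] (Adj-sym vu)

  ∈N⟨⟩⁺ : ∀ {X} → x ∈ X → Adj G x v → v ∈ N⟨_⟩ G X
  ∈N⟨⟩⁺ {x} {v} {X} x∈X xv = ∈tabulate⁺ (T-does⁺ (any? λ y → (lookup X y ∧ E y v) Bool.≟ true)
    (x , to T-≡ (from T-∧ (∈⇒T-lookup x∈X , from T-≡ xv))))

  ∈N⟨⟩⁻ : ∀ {X} → v ∈ N⟨_⟩ G X → ∃ λ x → x ∈ X × Adj G x v
  ∈N⟨⟩⁻ {v} {X} v∈ with T-does⁻ (any? λ y → (lookup X y ∧ E y v) Bool.≟ true) (∈tabulate⁻ v∈)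
  ... | x , x∈X∧xv with to T-∧ (from T-≡ x∈X∧xv)
  ...   | x∈X , xv = x , T-lookup⇒∈ x∈X , to T-≡ xv

  N⟨⊥⟩≡⊥ : N⟨_⟩ G ⊥ ≡ ⊥
  N⟨⊥⟩≡⊥ = Empty-unique λ (v , v∈) → ∉⊥ (proj₁ (proj₂ (∈N⟨⟩⁻ v∈)))

  Nonadjacent : Subset n → Subset n → Set
  Nonadjacent A B = ∀ {u v} → u ∈ A → v ∈ B → ¬ Adj G u v

  Independent : Subset n → Set
  Independent A = Nonadjacent A A

  Nonadjacent-sym : ∀ {A B} → Nonadjacent A B → Nonadjacent B A
  Nonadjacent-sym AB v∈B u∈A = AB u∈A v∈B ∘ Adj-sym

  Nonadjacent-mono : ∀ {A A′ B B′} → A′ ⊆ A → B′ ⊆ B → Nonadjacent A B → Nonadjacent A′ B′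
  Nonadjacent-mono A′⊆A B′⊆B AB u∈A′ v∈B′ = AB (A′⊆A u∈A′) (B′⊆B v∈B′)

  Independent-∪ : ∀ {A B} → Independent A → Independent B → Nonadjacent A B → Independent (A ∪ B)
  Independent-∪ {A} {B} indA indB AB u∈ v∈ uv with x∈p∪q⁻ A B u∈ | x∈p∪q⁻ A B v∈
  ... | inj₁ u∈A | inj₁ v∈A = indA u∈A v∈A uv
  ... | inj₁ u∈A | inj₂ v∈B = AB u∈A v∈B uv
  ... | inj₂ u∈B | inj₁ v∈A = AB v∈A u∈B (Adj-sym uv)
  ... | inj₂ u∈B | inj₂ v∈B = indB u∈B v∈B uv

  independent-dominating⇒minimal : ∀ {I} → Independent I → Dominating G I → MinimalDominating G I
  independent-dominating⇒minimal {I} indI domI = domI , minimal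
    where
    minimal : ∀ T → T ⊆ I → T ≢ I → ¬ Dominating G T
    minimal T T⊆I T≢I domT with ⊆∧≢⇒⊂ T⊆I T≢I
    ... | _ , x , x∈I , x∉T with domT x
    ... | y , y∈ with x∈p∩q⁻ (N[_] G x) T y∈
    ... | y∈N[x] , y∈T with ∈N[]⁻ y∈N[x]
    ... | inj₁ refl = x∉T y∈T
    ... | inj₂ xy   = indI x∈I (T⊆I y∈T) xy

  independent⇒⊆-independent-dominating : ∀ {I} → Independent I →
    ∃ λ J → I ⊆ J × Independent J × Dominating G J
  independent⇒⊆-independent-dominating indI = extend indI (<-wellFounded _)
    where
    extend : ∀ {I} → Independent I → Acc _<_ (n ∸ ∣ I ∣) → ∃ λ J → I ⊆ J × Independent J × Dominating G J
    extend {I} indI (acc smaller) with dominating? G I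
    ... | yes domI = I , ⊆-refl , indI , domI
    ... | no ¬domI with ¬∀⟶∃¬ n _ (λ v → nonempty? (N[_] G v ∩ I)) ¬domI
    ... | v , N[v]∩I=∅
      with extend (Independent-∪ ⁅v⁆-independent indI v-I-nonadjacent) (smaller n∸∣I∣-decreases)
      where
      ⁅v⁆-independent : Independent ⁅ v ⁆
      ⁅v⁆-independent u∈ w∈ uw rewrite x∈⁅y⁆⇒x≡y v u∈ | x∈⁅y⁆⇒x≡y v w∈ = Adj-irrefl uw
      v-I-nonadjacent : Nonadjacent ⁅ v ⁆ I
      v-I-nonadjacent u∈ w∈I uw rewrite x∈⁅y⁆⇒x≡y v u∈ = N[v]∩I=∅ (_ , x∈p∩q⁺ (Adj⇒∈N[] uw , w∈I))
      v∉I : v ∉ I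
      v∉I v∈I = N[v]∩I=∅ (v , x∈p∩q⁺ (v∈N[v] v , v∈I))
      n∸∣I∣-decreases : n ∸ ∣ ⁅ v ⁆ ∪ I ∣ < n ∸ ∣ I ∣
      n∸∣I∣-decreases = ∸-monoʳ-<
        (p⊂q⇒∣p∣<∣q∣ (q⊆p∪q ⁅ v ⁆ I , v , x∈p∪q⁺ (inj₁ (x∈⁅x⁆ v)) , v∉I)) (∣p∣≤n (⁅ v ⁆ ∪ I))
    ... | J , v∪I⊆J , indJ , domJ = J , ⊆-trans (q⊆p∪q ⁅ v ⁆ I) v∪I⊆J , indJ , domJ

  independent⇒∣I∣≤Γ : ∀ {M I} → MaxMinimalDominating G M → Independent I → ∣ I ∣ ≤ ∣ M ∣
  independent⇒∣I∣≤Γ (_ , maximum) indI with independent⇒⊆-independent-dominating indI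
  ... | J , I⊆J , indJ , domJ =
    ≤-trans (p⊆q⇒∣p∣≤∣q∣ I⊆J) (maximum J (independent-dominating⇒minimal indJ domJ))

  Bipartite : Set
  Bipartite = ∃ λ C → Independent C × Independent (∁ C)

  nonadjacent⇒∣Q∣+∣R∣≤k+k : ∀ {k} → Bipartite → (∀ {I} → Independent I → ∣ I ∣ ≤ k) →
    ∀ {Q R} → Nonadjacent Q R → ∣ Q ∣ + ∣ R ∣ ≤ k + k
  nonadjacent⇒∣Q∣+∣R∣≤k+k {k} (C , indC , ind∁C) bound {Q} {R} QR = begin
    ∣ Q ∣ + ∣ R ∣
      ≡⟨ cong₂ _+_ (∣p∣≡∣p∩q∣+∣p∩∁q∣ Q C) (∣p∣≡∣p∩q∣+∣p∩∁q∣ R C) ⟩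
    (∣ Q ∩ C ∣ + ∣ Q ∩ ∁ C ∣) + (∣ R ∩ C ∣ + ∣ R ∩ ∁ C ∣)
      ≡⟨ swap (∣ Q ∩ C ∣) (∣ Q ∩ ∁ C ∣) (∣ R ∩ C ∣) (∣ R ∩ ∁ C ∣) ⟩
    (∣ Q ∩ C ∣ + ∣ R ∩ ∁ C ∣) + (∣ R ∩ C ∣ + ∣ Q ∩ ∁ C ∣)
      ≡⟨ sym (cong₂ _+_ (∣mix∣ Q R) (∣mix∣ R Q)) ⟩
    ∣ mix Q R ∣ + ∣ mix R Q ∣
      ≤⟨ +-mono-≤ (bound (mix-independent QR)) (bound (mix-independent (Nonadjacent-sym QR))) ⟩
    k + k
      ∎
    where
    open ≤-Reasoning
    mix : Subset n → Subset n → Subset n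
    mix A B = A ∩ C ∪ B ∩ ∁ C
    ∣mix∣ : ∀ A B → ∣ mix A B ∣ ≡ ∣ A ∩ C ∣ + ∣ B ∩ ∁ C ∣
    ∣mix∣ A B = ∣p∪q∣≡∣p∣+∣q∣ (A ∩ C) (B ∩ ∁ C) (∩-∩∁-disjoint A C B)
    mix-independent : ∀ {A B} → Nonadjacent A B → Independent (mix A B)
    mix-independent {A} {B} AB = Independent-∪
      (Nonadjacent-mono (p∩q⊆q A C) (p∩q⊆q A C) indC)
      (Nonadjacent-mono (p∩q⊆q B (∁ C)) (p∩q⊆q B (∁ C)) ind∁C)
      (Nonadjacent-mono (p∩q⊆p A C) (p∩q⊆p B (∁ C)) AB)
    swap : ∀ a b c d → (a + b) + (c + d) ≡ (a + d) + (c + b)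
    swap = solve 4 (λ a b c d → (a :+ b) :+ (c :+ d) := (a :+ d) :+ (c :+ b)) refl
      where open +-*-Solver

  _++ʷ_ : Walk G u x → Walk G x v → Walk G u v
  here     ++ʷ q = q
  step e p ++ʷ q = step e (p ++ʷ q)

  length : Walk G u v → ℕ
  length here       = 0
  length (step _ p) = suc (length p)

  parity : Walk G u v → Bool
  parity here       = false
  parity (step _ p) = not (parity p)

  reverse-onto : Walk G u v → Walk G u w → Walk G v w
  reverse-onto here       q = q
  reverse-onto (step e p) q = reverse-onto p (step (Adj-sym e) q)

  length-++ : ∀ (p : Walk G u x) (q : Walk G x v) → length (p ++ʷ q) ≡ length p + length q
  length-++ here       q = refl
  length-++ (step _ p) q = cong suc (length-++ p q)

  parity-++ : ∀ (p : Walk G u x) (q : Walk G x v) → parity (p ++ʷ q) ≡ parity p xor parity q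
  parity-++ here       q = refl
  parity-++ (step _ p) q = trans (cong not (parity-++ p q)) (not-distribˡ-xor (parity p) (parity q))

  parity-reverse-onto : ∀ (p : Walk G u v) (q : Walk G u w) →
    parity (reverse-onto p q) ≡ parity p xor parity q
  parity-reverse-onto here       q = refl
  parity-reverse-onto (step _ p) q = trans (parity-reverse-onto p _)
    (trans (sym (not-distribʳ-xor (parity p) (parity q))) (not-distribˡ-xor (parity p) (parity q)))

  split-at : ∀ (p : Walk G u v) → x List.∈ verts G p →
    ∃₂ λ (p₁ : Walk G u x) (p₂ : Walk G x v) → p ≡ p₁ ++ʷ p₂
  split-at here       (here refl) = here , here , refl
  split-at (step e p) (here refl) = here , step e p , refl
  split-at (step e p) (there x∈p) with split-at p x∈p
  ... | p₁ , p₂ , p≡ = step e p₁ , p₂ , cong (step e) p≡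

  module _ (p₁ : Walk G u x) (e : Adj G x y) (c : Walk G y x) (p₂ : Walk G x v) where

    length-detour : length (p₁ ++ʷ step e (c ++ʷ p₂)) ≡ length p₁ + suc (length c + length p₂)
    length-detour = trans (length-++ p₁ _) (cong (λ k → length p₁ + suc k) (length-++ c p₂))

    loop-shorter : length c < length (p₁ ++ʷ step e (c ++ʷ p₂))
    loop-shorter = subst (length c <_) (sym length-detour)
      (≤-trans (s≤s (m≤m+n (length c) (length p₂))) (m≤n+m _ (length p₁)))

    bypass-shorter : length (p₁ ++ʷ p₂) < length (p₁ ++ʷ step e (c ++ʷ p₂))
    bypass-shorter = subst₂ _<_ (sym (length-++ p₁ p₂)) (sym length-detour)
      (+-monoʳ-< (length p₁) (s≤s (m≤n+m (length p₂) (length c))))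

    bypass-parity : parity c ≡ true → parity (p₁ ++ʷ p₂) ≡ parity (p₁ ++ʷ step e (c ++ʷ p₂))
    bypass-parity odd = begin
      parity (p₁ ++ʷ p₂)                          ≡⟨ parity-++ p₁ p₂ ⟩
      parity p₁ xor parity p₂                     ≡⟨ cong (parity p₁ xor_) (sym (not-involutive _)) ⟩
      parity p₁ xor not (true xor parity p₂)
        ≡⟨ cong (λ b → parity p₁ xor not (b xor parity p₂)) (sym odd) ⟩
      parity p₁ xor not (parity c xor parity p₂)
        ≡⟨ cong (λ b → parity p₁ xor not b) (sym (parity-++ c p₂)) ⟩
      parity p₁ xor parity (step e (c ++ʷ p₂))    ≡⟨ sym (parity-++ p₁ _) ⟩
      parity (p₁ ++ʷ step e (c ++ʷ p₂))           ∎
      where open ≡-Reasoning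

  record Revisit (p : Walk G u v) : Set where
    constructor revisit
    field
      {pivot next} : Fin n
      prefix       : Walk G u pivot
      exit         : Adj G pivot next
      loop         : Walk G next pivot
      suffix       : Walk G pivot v
      split        : p ≡ prefix ++ʷ step exit (loop ++ʷ suffix)

  unique⊎revisit : ∀ (p : Walk G u v) → Unique (verts G p) ⊎ Revisit p
  unique⊎revisit here = inj₁ ([] ∷ [])
  unique⊎revisit {u} (step e p) with unique⊎revisit p | u ∈? verts G p
  ... | inj₂ (revisit p₁ e′ c p₂ p≡) | _ = inj₂ (revisit (step e p₁) e′ c p₂ (cong (step e) p≡))
  ... | inj₁ uniq | no u∉p  = inj₁ (¬Any⇒All¬ _ u∉p ∷ uniq)
  ... | inj₁ _    | yes u∈p with split-at p u∈p
  ...   | p₁ , p₂ , p≡ = inj₂ (revisit here e p₁ p₂ (cong (step e) p≡))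

  -- A repeated vertex splits an odd closed walk into two shorter closed walks, one of them odd;
  -- an odd closed walk without repeated vertex is a cycle.
  odd-closed-walk⇒cycle : ∀ (c : Walk G u u) → parity c ≡ true → HasCycle G
  odd-closed-walk⇒cycle here       ()
  odd-closed-walk⇒cycle (step e p) odd = shorten p e (not-injective odd) (<-wellFounded (length p))
    where
    not-injective : ∀ {b} → not b ≡ true → b ≡ false
    not-injective {false} _ = refl

    path⇒cycle : ∀ (p : Walk G w u) → Adj G u w → parity p ≡ false → Unique (verts G p) → HasCycle G
    path⇒cycle here                           uw _  _    = contradiction uw Adj-irrefl
    path⇒cycle (step _ here)                  _  () _
    path⇒cycle p@(step _ (step _ here))       uw _  uniq = _ , _ , p , uw , uniq , s≤s (s≤s (s≤s z≤n))
    path⇒cycle p@(step _ (step _ (step _ _))) uw _  uniq = _ , _ , p , uw , uniq , s≤s (s≤s (s≤s z≤n))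

    shorten : ∀ (p : Walk G w u) → Adj G u w → parity p ≡ false → Acc _<_ (length p) → HasCycle G
    shorten p uw even (acc smaller) with unique⊎revisit p
    ... | inj₁ uniq = path⇒cycle p uw even uniq
    ... | inj₂ (revisit p₁ e c p₂ refl) with parity c in c-parity
    ...   | false = shorten c e c-parity (smaller (loop-shorter p₁ e c p₂))
    ...   | true  = shorten (p₁ ++ʷ p₂) uw (trans (bypass-parity p₁ e c p₂ c-parity) even)
                      (smaller (bypass-shorter p₁ e c p₂))

  tree⇒bipartite : IsTree G → Bipartite
  tree⇒bipartite (0<n , connected , acyclic) =
    C , (λ u∈ v∈ → properly-coloured (same-colour-in-C u∈ v∈))
      , (λ u∈ v∈ → properly-coloured (same-colour-in-∁C u∈ v∈))
    where
    root : Fin n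
    root = fromℕ< 0<n
    colour : Fin n → Bool
    colour v = parity (connected root v)
    C : Subset n
    C = tabulate colour
    properly-coloured : colour u ≡ colour v → ¬ Adj G u v
    properly-coloured {u} {v} same uv =
      acyclic (odd-closed-walk⇒cycle (step uv (reverse-onto (connected root v) (connected root u))) (cong not (begin
        parity (reverse-onto (connected root v) (connected root u))  ≡⟨ parity-reverse-onto (connected root v) _ ⟩
        colour v xor colour u                                        ≡⟨ cong (colour v xor_) same ⟩
        colour v xor colour v                                        ≡⟨ xor-same (colour v) ⟩
        false                                                        ∎)))
      where open ≡-Reasoning
    same-colour-in-C : u ∈ C → v ∈ C → colour u ≡ colour v
    same-colour-in-C u∈ v∈ = trans (to T-≡ (∈tabulate⁻ u∈)) (sym (to T-≡ (∈tabulate⁻ v∈)))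
    colour-∁C : u ∈ ∁ C → colour u ≡ false
    colour-∁C u∈ = to T-not-≡ (¬T⇒T-not (x∈∁p⇒x∉p u∈ ∘ ∈tabulate⁺))
    same-colour-in-∁C : u ∈ ∁ C → v ∈ ∁ C → colour u ≡ colour v
    same-colour-in-∁C u∈ v∈ = trans (colour-∁C u∈) (sym (colour-∁C v∈))

  module _ {S : Subset n} where

    ∈N₁⁺ : u ∉ S → ∣ N[_] G u ∩ S ∣ ≡ 1 → u ∈ N₁ G S
    ∈N₁⁺ u∉S one = ∈tabulate⁺ (from T-∧ (¬T⇒T-not (u∉S ∘ T-lookup⇒∈) , ≡⇒≡ᵇ _ 1 one))

    ∈N₁⁻ : u ∈ N₁ G S → u ∉ S × ∣ N[_] G u ∩ S ∣ ≡ 1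
    ∈N₁⁻ u∈ with to T-∧ (∈tabulate⁻ u∈)
    ... | u∉S , one = T-not⇒¬T u∉S ∘ ∈⇒T-lookup , ≡ᵇ⇒≡ _ 1 one

    ∈N₂⁻ : u ∈ N₂ G S → u ∉ S × 2 ≤ ∣ N[_] G u ∩ S ∣
    ∈N₂⁻ u∈ with to T-∧ (∈tabulate⁻ u∈)
    ... | u∉S , two = T-not⇒¬T u∉S ∘ ∈⇒T-lookup , ≤ᵇ⇒≤ 2 _ two

    ∈a⁻ : u ∈ a G S → u ∈ S × ¬ Dominating G (S - u)
    ∈a⁻ {u} u∈ with to T-∧ (∈tabulate⁻ u∈)
    ... | u∈S , ¬dom = T-lookup⇒∈ u∈S , T-not⇒¬T ¬dom ∘ T-does⁺ (dominating? G (S - u))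

    meetsN₁ : Subset n
    meetsN₁ = tabulate λ u → does (nonempty? (N[_] G u ∩ N₁ G S))

    a₁≡a∩meetsN₁ : a₁ G S ≡ a G S ∩ meetsN₁
    a₁≡a∩meetsN₁ = trans (tabulate-∧ (lookup (a G S)) _) (cong (_∩ meetsN₁) (tabulate∘lookup (a G S)))

    a₂≡a∩∁meetsN₁ : a₂ G S ≡ a G S ∩ ∁ meetsN₁
    a₂≡a∩∁meetsN₁ = trans (tabulate-∧ (lookup (a G S)) _)
      (cong₂ _∩_ (tabulate∘lookup (a G S)) (tabulate-∘ not λ u → does (nonempty? (N[_] G u ∩ N₁ G S))))

    ∣a∣≡∣a₁∣+∣a₂∣ : ∣ a G S ∣ ≡ ∣ a₁ G S ∣ + ∣ a₂ G S ∣
    ∣a∣≡∣a₁∣+∣a₂∣ = trans (∣p∣≡∣p∩q∣+∣p∩∁q∣ (a G S) meetsN₁)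
      (sym (cong₂ _+_ (cong ∣_∣ a₁≡a∩meetsN₁) (cong ∣_∣ a₂≡a∩∁meetsN₁)))

    ∈a₁⁻ : u ∈ a₁ G S → u ∈ S × Nonempty (N[_] G u ∩ N₁ G S)
    ∈a₁⁻ {u} u∈ with x∈p∩q⁻ (a G S) meetsN₁ (subst (u ∈_) a₁≡a∩meetsN₁ u∈)
    ... | u∈a , u∈meets = proj₁ (∈a⁻ u∈a) , T-does⁻ (nonempty? _) (∈tabulate⁻ u∈meets)

    ∈a₂⁻ : u ∈ a₂ G S → u ∈ a G S × Empty (N[_] G u ∩ N₁ G S)
    ∈a₂⁻ {u} u∈ with x∈p∩q⁻ (a G S) (∁ meetsN₁) (subst (u ∈_) a₂≡a∩∁meetsN₁ u∈)
    ... | u∈a , u∈∁meets = u∈a , x∈∁p⇒x∉p u∈∁meets ∘ ∈tabulate⁺ ∘ T-does⁺ (nonempty? _)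

    minimal⇒a≡S : MinimalDominating G S → a G S ≡ S
    minimal⇒a≡S (_ , minimal) = trans (tabulate-cong every-vertex-essential) (tabulate∘lookup S)
      where
      S-u≢S : u ∈ S → S - u ≢ S
      S-u≢S u∈S S-u≡S = <-irrefl (cong ∣_∣ S-u≡S) (x∈p⇒∣p-x∣<∣p∣ u∈S)
      every-vertex-essential : ∀ u → lookup S u ∧ not (does (dominating? G (S - u))) ≡ lookup S u
      every-vertex-essential u = ∧-not-does (lookup S u) (dominating? G (S - u))
        λ u∈S → minimal (S - u) (p─q⊆p S ⁅ u ⁆) (S-u≢S (T-lookup⇒∈ u∈S))

    undominated⇒N[w]∩S≡⁅v⁆ : Dominating G S → Empty (N[_] G w ∩ (S - v)) → N[_] G w ∩ S ≡ ⁅ v ⁆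
    undominated⇒N[w]∩S≡⁅v⁆ {w} {v} dom N[w]∩S-v=∅ with dom w
    ... | y , y∈ = ≡⁅x⁆⁺ (subst (_∈ N[_] G w ∩ S) (only-v y∈) y∈) only-v
      where
      only-v : ∀ {y} → y ∈ N[_] G w ∩ S → y ≡ v
      only-v {y} y∈ with y ≟ v | x∈p∩q⁻ (N[_] G w) S y∈
      ... | yes y≡v | _         = y≡v
      ... | no y≢v  | y∈N , y∈S = contradiction (y , x∈p∩q⁺ (y∈N , x∈p∧x≢y⇒x∈p-y y∈S y≢v)) N[w]∩S-v=∅

    ∈a⇒isolated⊎meetsN₁ : Dominating G S → v ∈ a G S →
      Empty (N[_] G v ∩ (S - v)) ⊎ Nonempty (N[_] G v ∩ N₁ G S)
    ∈a⇒isolated⊎meetsN₁ {v} dom v∈a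
      with ¬∀⟶∃¬ n (λ w → Nonempty (N[_] G w ∩ (S - v))) (λ w → nonempty? _) (proj₂ (∈a⁻ v∈a))
    ... | w , N[w]∩S-v=∅ with w ≟ v
    ... | yes refl = inj₁ N[w]∩S-v=∅
    ... | no w≢v   =
      inj₂ (w , x∈p∩q⁺ (∈N[]-sym v∈N[w] , ∈N₁⁺ w∉S (trans (cong ∣_∣ N[w]∩S≡⁅v⁆) (∣⁅x⁆∣≡1 v))))
      where
      N[w]∩S≡⁅v⁆ : N[_] G w ∩ S ≡ ⁅ v ⁆
      N[w]∩S≡⁅v⁆ = undominated⇒N[w]∩S≡⁅v⁆ dom N[w]∩S-v=∅
      v∈N[w] : v ∈ N[_] G w
      v∈N[w] = proj₁ (x∈p∩q⁻ (N[_] G w) S (subst (v ∈_) (sym N[w]∩S≡⁅v⁆) (x∈⁅x⁆ v)))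
      w∉S : w ∉ S
      w∉S w∈S = w≢v (x∈⁅y⁆⇒x≡y v (subst (w ∈_) N[w]∩S≡⁅v⁆ (x∈p∩q⁺ (v∈N[v] w , w∈S))))

    S-a₂-nonadjacent : Dominating G S → Nonadjacent S (a₂ G S)
    S-a₂-nonadjacent dom u∈S v∈a₂ uv with ∈a₂⁻ v∈a₂
    ... | v∈a , N[v]∩N₁=∅ with ∈a⇒isolated⊎meetsN₁ dom v∈a
    ...   | inj₁ isolated = isolated (_ , x∈p∩q⁺ (Adj⇒∈N[] (Adj-sym uv) , x∈p∧x≢y⇒x∈p-y u∈S (Adj⇒≢ uv)))
    ...   | inj₂ meets    = N[v]∩N₁=∅ meets

    N₁-a₂-nonadjacent : Nonadjacent (N₁ G S) (a₂ G S)
    N₁-a₂-nonadjacent u∈N₁ v∈a₂ uv = proj₂ (∈a₂⁻ v∈a₂) (_ , x∈p∩q⁺ (Adj⇒∈N[] (Adj-sym uv) , u∈N₁))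

    S∩N₁=∅ : Empty (S ∩ N₁ G S)
    S∩N₁=∅ (u , u∈) with x∈p∩q⁻ S (N₁ G S) u∈
    ... | u∈S , u∈N₁ = proj₁ (∈N₁⁻ u∈N₁) u∈S

    S∪N₁∩N₂=∅ : Empty ((S ∪ N₁ G S) ∩ N₂ G S)
    S∪N₁∩N₂=∅ (u , u∈) with x∈p∩q⁻ (S ∪ N₁ G S) (N₂ G S) u∈
    ... | u∈S∪N₁ , u∈N₂ with x∈p∪q⁻ S (N₁ G S) u∈S∪N₁
    ...   | inj₁ u∈S  = proj₁ (∈N₂⁻ u∈N₂) u∈S
    ...   | inj₂ u∈N₁ = <-irrefl refl (subst (1 <_) (proj₂ (∈N₁⁻ u∈N₁)) (proj₂ (∈N₂⁻ u∈N₂)))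

    ∣a₁∣≤∣N₁∣ : ∣ a₁ G S ∣ ≤ ∣ N₁ G S ∣
    ∣a₁∣≤∣N₁∣ = injective-relation⇒∣p∣≤∣q∣ (a₁ G S) (N₁ G S) {R = λ u w → w ∈ N[_] G u}
      private-N₁-neighbour injective
      where
      private-N₁-neighbour : u ∈ a₁ G S → ∃ λ w → w ∈ N₁ G S × w ∈ N[_] G u
      private-N₁-neighbour {u} u∈a₁ with proj₂ (∈a₁⁻ u∈a₁)
      ... | w , w∈ with x∈p∩q⁻ (N[_] G u) (N₁ G S) w∈
      ...   | w∈N[u] , w∈N₁ = w , w∈N₁ , w∈N[u]
      injective : u ∈ a₁ G S → v ∈ a₁ G S → w ∈ N₁ G S → w ∈ N[_] G u → w ∈ N[_] G v → u ≡ v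
      injective u∈a₁ v∈a₁ w∈N₁ w∈N[u] w∈N[v] = ∣p∣≡1⇒unique (proj₂ (∈N₁⁻ w∈N₁))
        (x∈p∩q⁺ (∈N[]-sym w∈N[u] , proj₁ (∈a₁⁻ u∈a₁)))
        (x∈p∩q⁺ (∈N[]-sym w∈N[v] , proj₁ (∈a₁⁻ v∈a₁)))

  module _ {M : Subset n} (tree : IsTree G) (max : MaxMinimalDominating G M) where

    ∣N₁∣+∣X∣≤∣a₁∣+∣N⟨X⟩∩a₂∣ : ∀ {X} → X ⊆ N₂ G M →
      ∣ N₁ G M ∣ + ∣ X ∣ ≤ ∣ a₁ G M ∣ + ∣ N⟨_⟩ G X ∩ a₂ G M ∣
    ∣N₁∣+∣X∣≤∣a₁∣+∣N⟨X⟩∩a₂∣ {X} X⊆N₂ = +-cancelʳ-≤ r A B (+-cancelˡ-≤ m _ _ (begin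
      m + (A + r)  ≡⟨ sym (+-assoc m A r) ⟩
      (m + A) + r  ≡⟨ cong (_+ r) (sym ∣Q∣≡m+A) ⟩
      ∣ Q ∣ + r    ≤⟨ nonadjacent⇒∣Q∣+∣R∣≤k+k (tree⇒bipartite tree) (independent⇒∣I∣≤Γ max) QR ⟩
      m + m        ≡⟨ cong (m +_) m≡B+r ⟩
      m + (B + r)  ∎))
      where
      open ≤-Reasoning
      Q R : Subset n
      Q = (M ∪ N₁ G M) ∪ X
      R = a₂ G M ∩ ∁ (N⟨_⟩ G X)
      m A B r : ℕ
      m = ∣ M ∣
      A = ∣ N₁ G M ∣ + ∣ X ∣
      B = ∣ a₁ G M ∣ + ∣ N⟨_⟩ G X ∩ a₂ G M ∣
      r = ∣ R ∣
      QR : Nonadjacent Q R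
      QR u∈Q v∈R uv with x∈p∩q⁻ (a₂ G M) _ v∈R | x∈p∪q⁻ (M ∪ N₁ G M) X u∈Q
      ... | _ , v∉N⟨X⟩ | inj₂ u∈X = x∈p⇒x∉∁p (∈N⟨⟩⁺ u∈X uv) v∉N⟨X⟩
      ... | v∈a₂ , _    | inj₁ u∈M∪N₁ with x∈p∪q⁻ M (N₁ G M) u∈M∪N₁
      ...   | inj₁ u∈M  = S-a₂-nonadjacent (proj₁ (proj₁ max)) u∈M v∈a₂ uv
      ...   | inj₂ u∈N₁ = N₁-a₂-nonadjacent u∈N₁ v∈a₂ uv
      ∣Q∣≡m+A : ∣ Q ∣ ≡ m + A
      ∣Q∣≡m+A = begin-equality
        ∣ (M ∪ N₁ G M) ∪ X ∣     ≡⟨ ∣p∪q∣≡∣p∣+∣q∣ (M ∪ N₁ G M) X (Empty-∩-⊆ʳ X⊆N₂ S∪N₁∩N₂=∅) ⟩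
        ∣ M ∪ N₁ G M ∣ + ∣ X ∣    ≡⟨ cong (_+ ∣ X ∣) (∣p∪q∣≡∣p∣+∣q∣ M (N₁ G M) S∩N₁=∅) ⟩
        (m + ∣ N₁ G M ∣) + ∣ X ∣  ≡⟨ +-assoc m _ _ ⟩
        m + A                    ∎
      m≡B+r : m ≡ B + r
      m≡B+r = begin-equality
        ∣ M ∣                                     ≡⟨ cong ∣_∣ (sym (minimal⇒a≡S (proj₁ max))) ⟩
        ∣ a G M ∣                                 ≡⟨ ∣a∣≡∣a₁∣+∣a₂∣ ⟩
        ∣ a₁ G M ∣ + ∣ a₂ G M ∣
          ≡⟨ cong (∣ a₁ G M ∣ +_) (∣p∣≡∣p∩q∣+∣p∩∁q∣ (a₂ G M) (N⟨_⟩ G X)) ⟩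
        ∣ a₁ G M ∣ + (∣ a₂ G M ∩ N⟨_⟩ G X ∣ + r)
          ≡⟨ cong (λ s → ∣ a₁ G M ∣ + (∣ s ∣ + r)) (∩-comm (a₂ G M) _) ⟩
        ∣ a₁ G M ∣ + (∣ N⟨_⟩ G X ∩ a₂ G M ∣ + r)  ≡⟨ sym (+-assoc ∣ a₁ G M ∣ _ r) ⟩
        B + r                                     ∎

    ∣N₁∣≤∣a₁∣ : ∣ N₁ G M ∣ ≤ ∣ a₁ G M ∣
    ∣N₁∣≤∣a₁∣ = subst₂ _≤_
      (k+∣⊥∣≡k ∣ N₁ G M ∣)
      (trans (cong (λ s → ∣ a₁ G M ∣ + ∣ s ∣) N⟨⊥⟩∩a₂≡⊥) (k+∣⊥∣≡k ∣ a₁ G M ∣))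
      (∣N₁∣+∣X∣≤∣a₁∣+∣N⟨X⟩∩a₂∣ ⊥⊆)
      where
      k+∣⊥∣≡k : ∀ k → k + ∣ ⊥ {n = n} ∣ ≡ k
      k+∣⊥∣≡k k = trans (cong (k +_) (∣⊥∣≡0 n)) (+-identityʳ k)
      N⟨⊥⟩∩a₂≡⊥ : N⟨_⟩ G ⊥ ∩ a₂ G M ≡ ⊥
      N⟨⊥⟩∩a₂≡⊥ = trans (cong (_∩ a₂ G M) N⟨⊥⟩≡⊥) (∩-zeroˡ (a₂ G M))

theorem13 : (n : ℕ) (T : Graph n) → IsTree T → (M : Subset n) → MaxMinimalDominating T M →
    (∣ a₁ T M ∣ ≡ ∣ N₁ T M ∣) × ((X : Subset n) → X ⊆ N₂ T M → ∣ X ∣ ≤ ∣ N⟨_⟩ T X ∩ a₂ T M ∣)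
theorem13 n T tree M max = ≤-antisym (∣a₁∣≤∣N₁∣ T) (∣N₁∣≤∣a₁∣ T tree max) , ∣X∣≤∣N⟨X⟩∩a₂∣
  where
  ∣X∣≤∣N⟨X⟩∩a₂∣ : (X : Subset n) → X ⊆ N₂ T M → ∣ X ∣ ≤ ∣ N⟨_⟩ T X ∩ a₂ T M ∣
  ∣X∣≤∣N⟨X⟩∩a₂∣ X X⊆N₂ = +-cancelˡ-≤ ∣ N₁ T M ∣ _ _
    (≤-trans (∣N₁∣+∣X∣≤∣a₁∣+∣N⟨X⟩∩a₂∣ T tree max X⊆N₂) (+-monoˡ-≤ _ (∣a₁∣≤∣N₁∣ T)))
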